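{- Let $n\geq 2$ be an integer. Then there exists a matrix with $\lfloor n^{2}/6\rfloor$ rows and $2^{\lfloor n/(2\log_2 n)\rfloor}$ columns, with each entry colored red or blue, that contains no $n\times \lceil\log_2 n\rceil$ monochromatic submatrix (i.e. there are no $n$ rows and $\lceil\log_2 n\rceil$ columns whose intersection entries all have the same color). -}

module Defs where

open import Data.Nat using (ℕ; suc; _*_; _^_; _≤_; _<_)
open import Data.Fin using (Fin)
open import Data.Bool using (Bool)
open import Data.Product using (_×_; ∃-syntax)
open import Function.Definitions using (Injective)
open import Relation.Binary.PropositionalEquality using (_≡_)

-- A red/blue colouring of an r × c matrix (true = red, false = blue).
Coloring : ℕ → ℕ → Set
Coloring r c = Fin r → Fin c → Bool

HasMonoSubmatrix : ∀ {r c} → Coloring r c → ℕ → ℕ → Set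
HasMonoSubmatrix {r} {c} M a b =
  ∃[ R ] ∃[ C ] ∃[ col ]
    (Injective _≡_ _≡_ R × Injective _≡_ _≡_ C ×
     (∀ (i : Fin a) (j : Fin b) → M (R i) (C j) ≡ col))

-- IsFloorNOver2Log2 n k  :  k = ⌊ n / (2 log₂ n) ⌋  (for n ≥ 2).
-- Since log₂ n > 0, k·2·log₂ n ≤ n  ⇔  n^(2k) ≤ 2^n, so k is the floor iff
-- n^(2k) ≤ 2^n < n^(2(k+1)).
IsFloorNOver2Log2 : ℕ → ℕ → Set
IsFloorNOver2Log2 n k = (n ^ (2 * k) ≤ 2 ^ n) × (2 ^ n < n ^ (2 * suc k))

-- The union bound, derandomised. A colouring of the r × 2ᵏ matrix (r = ⌊n²/6⌋) is a point of
-- {0,1}^(r·2ᵏ), and it has a monochromatic n × b submatrix (b = ⌈log₂ n⌉) exactly when it lies in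
-- one of the 2·C(r,n)·C(2ᵏ,b) subcubes that fix the colour of some n × b rectangle; each of them
-- fixes nb coordinates. From n! ≥ (n/3)ⁿ we get C(r,n) ≤ (n²/6)ⁿ/n! ≤ (n/2)ⁿ ≤ 2^(nb)/2ⁿ, and
-- C(2ᵏ,b) ≤ 2^(kb) with 2^(kb+1) < 2ⁿ by the choice of k, so there are fewer than 2^(nb) such cubes
-- and their total volume is less than that of the whole space. A point outside all of them is
-- built one coordinate at a time, always moving into the half of the space in which the remaining
-- cubes have less than half of their volume.
{-# OPTIONS --safe #-}
module Submission where

open import Defs
open import Algebra.Properties.CommutativeSemigroup as CommSemigroupProperties using ()
open import Data.Bool.Base using (Bool; true; false; not; _∧_; if_then_else_)
open import Data.Fin.Base using (Fin; zero; suc; _↑ˡ_; _↑ʳ_; combine; remQuot)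
open import Data.Fin.Properties using (remQuot-combine; combine-remQuot; splitAt-↑ʳ)
  renaming (suc-injective to suc-injectiveᶠ)
open import Data.Fin.Subset using (Subset; inside; outside; ⊥; ⁅_⁆; _∪_; _∈_; _∉_; ∣_∣)
open import Data.Fin.Subset.Properties using (∉⊥; x∈⁅y⁆⇒x≡y; x∈p∪q⁻; ∪-identityˡ; ∣⊥∣≡0)
open import Data.List.Base using (List; []; _∷_; _++_; map; length; cartesianProduct; cartesianProductWith)
open import Data.List.Membership.Propositional using () renaming (_∈_ to _∈ˡ_)
open import Data.List.Membership.Propositional.Properties
  using (∈-map⁺; ∈-map⁻; ∈-++⁺ˡ; ∈-++⁺ʳ; ∈-++⁻; ∈-cartesianProductWith⁺; ∈-cartesianProductWith⁻;
         ∈-cartesianProduct⁺; ∈-cartesianProduct⁻)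
open import Data.List.Properties using (length-map; length-++)
open import Data.List.Relation.Unary.All using (All; []; _∷_; tabulate) renaming (lookup to All-lookup)
import Data.List.Relation.Unary.Any as Any
open import Data.Maybe.Base using (Maybe; just; nothing)
open import Data.Maybe.Properties using (just-injective)
open import Data.Nat
open import Data.Nat.Combinatorics using (_C_; _P_; nCk≡nPk/k!; k>n⇒nCk≡0; nCk+nC[k+1]≡[n+1]C[k+1])
open import Data.Nat.Combinatorics.Base using (_P′_)
open import Data.Nat.DivMod using (_/_; m/n*n≤m)
open import Data.Nat.ListAction using (sum)
open import Data.Nat.Logarithm using (⌈log₂_⌉)
open import Data.Nat.Logarithm.Core using (⌈log2⌉)
open import Data.Nat.Properties
open import Data.Nat.Tactic.RingSolver using (solve-∀)
open import Data.Product using (Σ; _,_; _×_; ∃-syntax; uncurry; map₁; proj₁)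
open import Data.Sum.Base using (inj₁; inj₂)
open import Data.Vec.Base using ([]; _∷_; lookup; here; there)
open import Data.Vec.Functional using (Vector; tail) renaming (_∷_ to _◂_)
open import Data.Vec.Properties using (lookup⇒[]=)
open import Function.Base using (_∘_)
open import Function.Definitions using (Injective)
open import Induction.WellFounded using (Acc; acc)
open import Relation.Binary.PropositionalEquality
open import Relation.Nullary using (¬_; yes; no; contradiction)

-- Binomial coefficients, factorials and logarithms

nPk≤n^k : ∀ n k → n P k ≤ n ^ k
nPk≤n^k n k with k ≤ᵇ n
... | true  = nP′k≤n^k k
  where
  nP′k≤n^k : ∀ k → n P′ k ≤ n ^ k
  nP′k≤n^k zero    = ≤-refl
  nP′k≤n^k (suc k) = *-mono-≤ (m∸n≤m n k) (nP′k≤n^k k)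
... | false = z≤n

nCk*k!≤n^k : ∀ n k → (n C k) * k ! ≤ n ^ k
nCk*k!≤n^k n k with k ≤? n
... | yes k≤n = begin
  (n C k) * k !         ≡⟨ cong (_* k !) (nCk≡nPk/k! k≤n) ⟩
  ((n P k) / k !) * k ! ≤⟨ m/n*n≤m (n P k) (k !) ⟩
  n P k               ≤⟨ nPk≤n^k n k ⟩
  n ^ k               ∎
  where open ≤-Reasoning; instance _ = k !≢0
... | no k≰n rewrite k>n⇒nCk≡0 (≰⇒> k≰n) = z≤n

nCk≤n^k : ∀ n k → n C k ≤ n ^ k
nCk≤n^k n k = ≤-trans (m≤m*n (n C k) (k !)) (nCk*k!≤n^k n k)
  where instance _ = k !≢0

^-distribʳ-* : ∀ m n o → (m * n) ^ o ≡ m ^ o * n ^ o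
^-distribʳ-* m n zero    = refl
^-distribʳ-* m n (suc o) = begin
  m * n * (m * n) ^ o       ≡⟨ cong (m * n *_) (^-distribʳ-* m n o) ⟩
  m * n * (m ^ o * n ^ o)   ≡⟨ interchange m n (m ^ o) (n ^ o) ⟩
  m * m ^ o * (n * n ^ o)   ∎
  where
  open ≡-Reasoning
  open CommSemigroupProperties *-commutativeSemigroup using (interchange)

-- n²·(1 + j/n + (j/n)²), which bounds n²·(1 + 1/n)ʲ for j ≤ n; at j = n this gives (1 + 1/n)ⁿ ≤ 3.
quadratic : ℕ → ℕ → ℕ
quadratic n j = n * n + j * n + j * j

quadratic-step : ∀ {j n} → j ≤ n → suc n * quadratic n j ≤ n * quadratic n (suc j)
quadratic-step {j} {n} j≤n with n ∸ j | m+[n∸m]≡n j≤n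
... | t | refl = ≤-trans (m≤m+n _ (j + t * j + t)) (≤-reflexive (identity j t))
  where
  identity : ∀ j t → let n = j + t in
             suc n * (n * n + j * n + j * j) + (j + t * j + t) ≡ n * (n * n + suc j * n + suc j * suc j)
  identity = solve-∀

n*n*[1+n]^j≤n^j*quadratic : ∀ {n j} → j ≤ n → n * n * suc n ^ j ≤ n ^ j * quadratic n j
n*n*[1+n]^j≤n^j*quadratic {n} {zero}  _    = ≤-reflexive (identity n)
  where
  identity : ∀ n → n * n * 1 ≡ 1 * (n * n + 0 * n + 0 * 0)
  identity = solve-∀
n*n*[1+n]^j≤n^j*quadratic {n} {suc j} j<n = begin
  n * n * (suc n * suc n ^ j)   ≡⟨ x∙yz≈y∙xz (n * n) (suc n) (suc n ^ j) ⟩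
  suc n * (n * n * suc n ^ j)   ≤⟨ *-monoʳ-≤ (suc n) (n*n*[1+n]^j≤n^j*quadratic j≤n) ⟩
  suc n * (n ^ j * quadratic n j) ≡⟨ x∙yz≈y∙xz (suc n) (n ^ j) (quadratic n j) ⟩
  n ^ j * (suc n * quadratic n j) ≤⟨ *-monoʳ-≤ (n ^ j) (quadratic-step j≤n) ⟩
  n ^ j * (n * quadratic n (suc j)) ≡⟨ x∙yz≈yx∙z (n ^ j) n (quadratic n (suc j)) ⟩
  n * n ^ j * quadratic n (suc j) ∎
  where
  open ≤-Reasoning
  open CommSemigroupProperties *-commutativeSemigroup using (x∙yz≈y∙xz; x∙yz≈yx∙z)
  j≤n = <⇒≤ j<n

[1+n]^n≤3*n^n : ∀ n → suc n ^ n ≤ 3 * n ^ n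
[1+n]^n≤3*n^n zero      = s≤s z≤n
[1+n]^n≤3*n^n n@(suc _) = *-cancelˡ-≤ (n * n) (begin
  n * n * suc n ^ n           ≤⟨ n*n*[1+n]^j≤n^j*quadratic {n} {n} ≤-refl ⟩
  n ^ n * quadratic n n       ≡⟨ identity (n ^ n) n ⟩
  n * n * (3 * n ^ n)         ∎)
  where
  open ≤-Reasoning
  identity : ∀ x n → x * (n * n + n * n + n * n) ≡ n * n * (3 * x)
  identity = solve-∀

n^n≤3^n*n! : ∀ n → n ^ n ≤ 3 ^ n * n !
n^n≤3^n*n! zero    = ≤-refl
n^n≤3^n*n! (suc n) = begin
  suc n * suc n ^ n             ≤⟨ *-monoʳ-≤ (suc n) ([1+n]^n≤3*n^n n) ⟩
  suc n * (3 * n ^ n)           ≤⟨ *-monoʳ-≤ (suc n) (*-monoʳ-≤ 3 (n^n≤3^n*n! n)) ⟩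
  suc n * (3 * (3 ^ n * n !))   ≡⟨ identity (suc n) (3 ^ n) (n !) ⟩
  3 * 3 ^ n * (suc n * n !)     ∎
  where
  open ≤-Reasoning
  identity : ∀ s a f → s * (3 * (a * f)) ≡ 3 * a * (s * f)
  identity = solve-∀

n≤2*⌈n/2⌉ : ∀ n → n ≤ 2 * ⌈ n /2⌉
n≤2*⌈n/2⌉ zero          = z≤n
n≤2*⌈n/2⌉ (suc zero)    = s≤s z≤n
n≤2*⌈n/2⌉ (suc (suc n)) =
  ≤-trans (s≤s (s≤s (n≤2*⌈n/2⌉ n))) (≤-reflexive (sym (*-distribˡ-+ 2 1 ⌈ n /2⌉)))

2*⌈n/2⌉≤1+n : ∀ n → 2 * ⌈ n /2⌉ ≤ suc n
2*⌈n/2⌉≤1+n zero          = z≤n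
2*⌈n/2⌉≤1+n (suc zero)    = ≤-refl
2*⌈n/2⌉≤1+n (suc (suc n)) =
  ≤-trans (≤-reflexive (*-distribˡ-+ 2 1 ⌈ n /2⌉)) (s≤s (s≤s (2*⌈n/2⌉≤1+n n)))

n≤2^⌈log2⌉n : ∀ n (rec : Acc _<_ n) → n ≤ 2 ^ ⌈log2⌉ n rec
n≤2^⌈log2⌉n zero          _        = z≤n
n≤2^⌈log2⌉n (suc zero)    _        = ≤-refl
n≤2^⌈log2⌉n (suc (suc n)) (acc rs) = begin
  2 + n                          ≤⟨ +-monoʳ-≤ 2 (n≤2*⌈n/2⌉ n) ⟩
  2 + 2 * ⌈ n /2⌉                ≡⟨ *-distribˡ-+ 2 1 ⌈ n /2⌉ ⟨
  2 * suc ⌈ n /2⌉                ≤⟨ *-monoʳ-≤ 2 (n≤2^⌈log2⌉n (suc ⌈ n /2⌉) _) ⟩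
  2 * 2 ^ ⌈log2⌉ (suc ⌈ n /2⌉) _ ∎
  where open ≤-Reasoning

2^⌈log2⌉n≤2*[n∸1] : ∀ n (rec : Acc _<_ n) → 2 ≤ n → 2 ^ ⌈log2⌉ n rec ≤ 2 * (n ∸ 1)
2^⌈log2⌉n≤2*[n∸1] (suc zero)          _        (s≤s ())
2^⌈log2⌉n≤2*[n∸1] (suc (suc zero))    (acc _)  _ = ≤-refl
2^⌈log2⌉n≤2*[n∸1] (suc (suc (suc n))) (acc rs) _ = *-monoʳ-≤ 2 (≤-trans
  (2^⌈log2⌉n≤2*[n∸1] (suc ⌈ suc n /2⌉) (rs (⌈n/2⌉<n (suc n))) (s≤s (s≤s z≤n)))
  (2*⌈n/2⌉≤1+n (suc n)))

n≤2^⌈log₂n⌉ : ∀ n → n ≤ 2 ^ ⌈log₂ n ⌉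
n≤2^⌈log₂n⌉ n = n≤2^⌈log2⌉n n _

2^⌈log₂n⌉<2n : ∀ {n} → 2 ≤ n → 2 ^ ⌈log₂ n ⌉ < 2 * n
2^⌈log₂n⌉<2n {n} 2≤n =
  ≤-<-trans (2^⌈log2⌉n≤2*[n∸1] n _ 2≤n) (*-monoʳ-< 2 (∸-monoʳ-< {n} {1} {0} z<s (≤-trans (s≤s z≤n) 2≤n)))

^-cancelˡ-≤ : ∀ m {a c} → 1 < m → m ^ a ≤ m ^ c → a ≤ c
^-cancelˡ-≤ m 1<m m^a≤m^c = ≮⇒≥ (λ c<a → <⇒≱ (^-monoʳ-< m 1<m c<a) m^a≤m^c)

^-cancelˡ-< : ∀ m {a c} → 1 < m → m ^ a < m ^ c → a < c
^-cancelˡ-< m 1<m m^a<m^c = ≰⇒> (λ c≤a → <⇒≱ m^a<m^c (^-monoʳ-≤ m c≤a))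
  where instance _ = >-nonZero (<-trans z<s 1<m)

2*[2*k]≤n : ∀ {n k} → 4 ≤ n → n ^ (2 * k) ≤ 2 ^ n → 2 * (2 * k) ≤ n
2*[2*k]≤n {n} {k} 4≤n n^2k≤2^n = ^-cancelˡ-≤ 2 (s≤s (s≤s z≤n)) (begin
  2 ^ (2 * (2 * k))   ≡⟨ ^-*-assoc 2 2 (2 * k) ⟨
  4 ^ (2 * k)         ≤⟨ ^-monoˡ-≤ (2 * k) 4≤n ⟩
  n ^ (2 * k)         ≤⟨ n^2k≤2^n ⟩
  2 ^ n               ∎)
  where open ≤-Reasoning

b*[2*k]<2*k+n : ∀ {n k b} .{{_ : NonZero k}} → n ^ (2 * k) ≤ 2 ^ n → 2 ^ b < 2 * n → b * (2 * k) < 2 * k + n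
b*[2*k]<2*k+n {n} {k} {b} n^2k≤2^n 2^b<2n = ^-cancelˡ-< 2 (s≤s (s≤s z≤n)) (begin-strict
  2 ^ (b * (2 * k))          ≡⟨ ^-*-assoc 2 b (2 * k) ⟨
  (2 ^ b) ^ (2 * k)          <⟨ ^-monoˡ-< (2 * k) 2^b<2n ⟩
  (2 * n) ^ (2 * k)          ≡⟨ ^-distribʳ-* 2 n (2 * k) ⟩
  2 ^ (2 * k) * n ^ (2 * k)  ≤⟨ *-monoʳ-≤ (2 ^ (2 * k)) n^2k≤2^n ⟩
  2 ^ (2 * k) * 2 ^ n        ≡⟨ ^-distribˡ-+-* 2 (2 * k) n ⟨
  2 ^ (2 * k + n)            ∎)
  where
  open ≤-Reasoning
  instance _ = m*n≢0 2 k

1+k*b<n : ∀ {n k b} → 4 ≤ n → n ^ (2 * k) ≤ 2 ^ n → 2 ^ b < 2 * n → 1 + k * b < n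
1+k*b<n {n} {zero}       4≤n _         _      = ≤-trans (s≤s (s≤s z≤n)) 4≤n
1+k*b<n {n} {k@(suc k′)} {b} 4≤n n^2k≤2^n 2^b<2n = *-cancelˡ-< 2 _ _ (begin-strict
  2 * (1 + k * b)     ≡⟨ identity₁ k b ⟩
  b * (2 * k) + 2     <⟨ +-monoˡ-< 2 (b*[2*k]<2*k+n {n} {k} {b} n^2k≤2^n 2^b<2n) ⟩
  2 * k + n + 2       ≡⟨ identity₂ (2 * k) n ⟩
  n + (2 * k + 2)     ≤⟨ +-monoʳ-≤ n 2k+2≤n ⟩
  n + n               ≡⟨ cong (n +_) (+-identityʳ n) ⟨
  2 * n               ∎)
  where
  open ≤-Reasoning
  identity₁ : ∀ k b → 2 * (1 + k * b) ≡ b * (2 * k) + 2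
  identity₁ = solve-∀
  identity₂ : ∀ x n → x + n + 2 ≡ n + (x + 2)
  identity₂ = solve-∀
  identity₃ : ∀ k′ → 2 * (1 + k′) + 2 + 2 * k′ ≡ 2 * (2 * (1 + k′))
  identity₃ = solve-∀
  2k+2≤n : 2 * k + 2 ≤ n
  2k+2≤n = begin
    2 * k + 2            ≤⟨ m≤m+n (2 * k + 2) (2 * k′) ⟩
    2 * k + 2 + 2 * k′   ≡⟨ identity₃ k′ ⟩
    2 * (2 * k)          ≤⟨ 2*[2*k]≤n {n} {k} 4≤n n^2k≤2^n ⟩
    n                    ∎

⌊n²/6⌋Cn*2^n≤n^n : ∀ n → ((n * n / 6) C n) * 2 ^ n ≤ n ^ n
⌊n²/6⌋Cn*2^n≤n^n n = *-cancelʳ-≤ _ _ (3 ^ n * n !) (begin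
  (r C n) * 2 ^ n * (3 ^ n * n !) ≡⟨ identity ((r C n)) (2 ^ n) (3 ^ n) (n !) ⟩
  (r C n) * n ! * (3 ^ n * 2 ^ n) ≡⟨ cong ((r C n) * n ! *_) (^-distribʳ-* 3 2 n) ⟨
  (r C n) * n ! * 6 ^ n           ≤⟨ *-monoˡ-≤ (6 ^ n) (nCk*k!≤n^k r n) ⟩
  r ^ n * 6 ^ n                   ≡⟨ ^-distribʳ-* r 6 n ⟨
  (r * 6) ^ n                     ≤⟨ ^-monoˡ-≤ n (m/n*n≤m (n * n) 6) ⟩
  (n * n) ^ n                     ≡⟨ ^-distribʳ-* n n n ⟩
  n ^ n * n ^ n                   ≤⟨ *-monoʳ-≤ (n ^ n) (n^n≤3^n*n! n) ⟩
  n ^ n * (3 ^ n * n !)           ∎)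
  where
  open ≤-Reasoning
  r = n * n / 6
  instance _ = m*n≢0 (3 ^ n) (n !) {{m^n≢0 3 n}} {{n !≢0}}
  identity : ∀ a b c d → a * b * (c * d) ≡ a * d * (c * b)
  identity = solve-∀

union-bound-estimate : ∀ n k → 2 ≤ n → n ^ (2 * k) ≤ 2 ^ n →
  ((n * n / 6) C n) * (((2 ^ k) C ⌈log₂ n ⌉) * 2) < 2 ^ (n * ⌈log₂ n ⌉)
union-bound-estimate (suc zero)                k (s≤s ()) _
-- For n ≤ 3 there are fewer than n rows, so the first binomial coefficient vanishes.
union-bound-estimate (suc (suc zero))          k _ _ = z<s
union-bound-estimate (suc (suc (suc zero)))    k _ _ = z<s
union-bound-estimate n@(suc (suc (suc (suc _)))) k 2≤n n^2k≤2^n = *-cancelʳ-< (2 ^ n) _ _ (begin-strict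
  A * (B * 2) * 2 ^ n             ≡⟨ identity A B (2 ^ n) ⟩
  A * 2 ^ n * (2 * B)             ≤⟨ *-mono-≤ (⌊n²/6⌋Cn*2^n≤n^n n) (*-monoʳ-≤ 2 B≤2^[k*b]) ⟩
  n ^ n * 2 ^ (1 + k * b)         ≤⟨ *-monoˡ-≤ (2 ^ (1 + k * b)) n^n≤2^[n*b] ⟩
  2 ^ (n * b) * 2 ^ (1 + k * b)   <⟨ *-monoʳ-< (2 ^ (n * b)) {{m^n≢0 2 (n * b)}}
                                       (^-monoʳ-< 2 (s≤s (s≤s z≤n)) 1+k*b<n′) ⟩
  2 ^ (n * b) * 2 ^ n             ∎)
  where
  open ≤-Reasoning
  b = ⌈log₂ n ⌉
  A = (n * n / 6) C n
  B = (2 ^ k) C b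
  identity : ∀ a b c → a * (b * 2) * c ≡ a * c * (2 * b)
  identity = solve-∀
  B≤2^[k*b] : B ≤ 2 ^ (k * b)
  B≤2^[k*b] = ≤-trans (nCk≤n^k (2 ^ k) b) (≤-reflexive (^-*-assoc 2 k b))
  n^n≤2^[n*b] : n ^ n ≤ 2 ^ (n * b)
  n^n≤2^[n*b] = ≤-trans (^-monoˡ-≤ n (n≤2^⌈log₂n⌉ n))
                        (≤-reflexive (trans (^-*-assoc 2 b n) (cong (2 ^_) (*-comm b n))))
  1+k*b<n′ : 1 + k * b < n
  1+k*b<n′ = 1+k*b<n {n} {k} {b} (s≤s (s≤s (s≤s (s≤s z≤n)))) n^2k≤2^n (2^⌈log₂n⌉<2n 2≤n)

-- Subcubes of {0,1}ᴺ and a constructive union bound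

-- A partial assignment of N coordinates: the subcube of {0,1}ᴺ of points
-- agreeing with it wherever it is defined.
Cube : ℕ → Set
Cube N = Vector (Maybe Bool) N

_∈ᶜ_ : ∀ {N} → Vector Bool N → Cube N → Set
x ∈ᶜ c = ∀ p {v} → c p ≡ just v → x p ≡ v

_∉ᶜ_ : ∀ {N} → Vector Bool N → Cube N → Set
x ∉ᶜ c = ¬ x ∈ᶜ c

unfixed : Maybe Bool → ℕ
unfixed nothing  = 1
unfixed (just _) = 0

free : ∀ {N} → Cube N → ℕ
free {zero}  c = 0
free {suc N} c = unfixed (c zero) + free (tail c)

free-cong : ∀ {N} {c d : Cube N} → (∀ p → c p ≡ d p) → free c ≡ free d
free-cong {zero}  _   = refl
free-cong {suc N} c≗d = cong₂ _+_ (cong unfixed (c≗d zero)) (free-cong (c≗d ∘ suc))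

free-++ : ∀ m {k} (c : Cube (m + k)) →
          free c ≡ free (λ j → c (j ↑ˡ k)) + free (λ q → c (m ↑ʳ q))
free-++ zero    c = refl
free-++ (suc m) c =
  trans (cong (unfixed (c zero) +_) (free-++ m (c ∘ suc))) (sym (+-assoc (unfixed (c zero)) _ _))

free-unconstrained : ∀ N → free {N} (λ _ → nothing) ≡ N
free-unconstrained zero    = refl
free-unconstrained (suc N) = cong suc (free-unconstrained N)

volume : ∀ {N} → List (Cube N) → ℕ
volume cs = sum (map (λ c → 2 ^ free c) cs)

meets : Bool → Maybe Bool → Bool
meets _     nothing  = true
meets false (just w) = not w
meets true  (just w) = w

-- The cubes meeting the hyperplane x₀ = v, as cubes in the other coordinates.
slice : ∀ {N} → Bool → List (Cube (suc N)) → List (Cube N)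
slice v []       = []
slice v (c ∷ cs) = if meets v (c zero) then tail c ∷ slice v cs else slice v cs

volume-slices : ∀ {N} (cs : List (Cube (suc N))) →
                volume (slice false cs) + volume (slice true cs) ≡ volume cs
volume-slices []       = refl
volume-slices (c ∷ cs) with c zero | volume-slices cs
... | nothing    | ih = trans (identity (2 ^ free (tail c)) _ _) (cong (_ +_) ih)
  where
  identity : ∀ x a b → (x + a) + (x + b) ≡ (x + (x + 0)) + (a + b)
  identity = solve-∀
... | just false | ih = trans (+-assoc (2 ^ free (tail c)) _ _) (cong (_ +_) ih)
... | just true  | ih = trans (x∙yz≈y∙xz (volume (slice false cs)) (2 ^ free (tail c)) _) (cong (_ +_) ih)
  where open CommSemigroupProperties +-commutativeSemigroup using (x∙yz≈y∙xz)

∈ᶜ-tail : ∀ {N} {v} {y : Vector Bool N} {c : Cube (suc N)} → (v ◂ y) ∈ᶜ c → y ∈ᶜ tail c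
∈ᶜ-tail v◂y∈c p = v◂y∈c (suc p)

∉ᶜ-conflict : ∀ {N} {v w} {y : Vector Bool N} {c : Cube (suc N)} → c zero ≡ just w → v ≢ w → (v ◂ y) ∉ᶜ c
∉ᶜ-conflict c₀≡w v≢w v◂y∈c = v≢w (v◂y∈c zero c₀≡w)

slice-∉ᶜ : ∀ {N} v (y : Vector Bool N) (cs : List (Cube (suc N))) →
           All (y ∉ᶜ_) (slice v cs) → All ((v ◂ y) ∉ᶜ_) cs
slice-∉ᶜ v y []       _      = []
slice-∉ᶜ v y (c ∷ cs) avoids with c zero in c₀≡ | avoids
... | nothing    | a ∷ as = (a ∘ ∈ᶜ-tail) ∷ slice-∉ᶜ v y cs as
slice-∉ᶜ false y (c ∷ cs) _ | just false | a ∷ as = (a ∘ ∈ᶜ-tail) ∷ slice-∉ᶜ false y cs as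
slice-∉ᶜ true  y (c ∷ cs) _ | just true  | a ∷ as = (a ∘ ∈ᶜ-tail) ∷ slice-∉ᶜ true y cs as
slice-∉ᶜ false y (c ∷ cs) _ | just true  | as     = ∉ᶜ-conflict c₀≡ (λ ()) ∷ slice-∉ᶜ false y cs as
slice-∉ᶜ true  y (c ∷ cs) _ | just false | as     = ∉ᶜ-conflict c₀≡ (λ ()) ∷ slice-∉ᶜ true y cs as

avoid-cubes : ∀ N (cs : List (Cube N)) → volume cs < 2 ^ N → ∃[ x ] All (x ∉ᶜ_) cs
avoid-cubes zero    []       _  = (λ ()) , []
avoid-cubes zero    (c ∷ cs) (s≤s ())
avoid-cubes (suc N) cs vol<2^[1+N] with volume (slice false cs) <? 2 ^ N
... | yes vol₀<2^N = let x , avoids = avoid-cubes N (slice false cs) vol₀<2^N in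
                     false ◂ x , slice-∉ᶜ false x cs avoids
... | no  vol₀≮2^N = let x , avoids = avoid-cubes N (slice true cs) vol₁<2^N in
                     true ◂ x , slice-∉ᶜ true x cs avoids
  where
  open ≤-Reasoning
  vol₁<2^N : volume (slice true cs) < 2 ^ N
  vol₁<2^N = +-cancelˡ-< (2 ^ N) _ _ (begin-strict
    2 ^ N + volume (slice true cs)                     ≤⟨ +-monoˡ-≤ _ (≮⇒≥ vol₀≮2^N) ⟩
    volume (slice false cs) + volume (slice true cs)   ≡⟨ volume-slices cs ⟩
    volume cs                                          <⟨ vol<2^[1+N] ⟩
    2 ^ N + (2 ^ N + 0)                                ≡⟨ cong (2 ^ N +_) (+-identityʳ (2 ^ N)) ⟩
    2 ^ N + 2 ^ N                                      ∎)

volume-of-codimension : ∀ {N d} (cs : List (Cube N)) → All (λ c → free c + d ≡ N) cs →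
                        volume cs * 2 ^ d ≡ length cs * 2 ^ N
volume-of-codimension             []       []         = refl
volume-of-codimension {N} {d} (c ∷ cs) (free+d≡N ∷ fs) = begin
  (2 ^ free c + volume cs) * 2 ^ d         ≡⟨ *-distribʳ-+ (2 ^ d) (2 ^ free c) (volume cs) ⟩
  2 ^ free c * 2 ^ d + volume cs * 2 ^ d   ≡⟨ cong₂ _+_ 2^[free+d]≡2^N (volume-of-codimension cs fs) ⟩
  2 ^ N + length cs * 2 ^ N                ∎
  where
  open ≡-Reasoning
  2^[free+d]≡2^N : 2 ^ free c * 2 ^ d ≡ 2 ^ N
  2^[free+d]≡2^N = trans (sym (^-distribˡ-+-* 2 (free c) d)) (cong (2 ^_) free+d≡N)

avoid-cubes-of-codimension : ∀ {N} d (cs : List (Cube N)) → All (λ c → free c + d ≡ N) cs →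
                             length cs < 2 ^ d → ∃[ x ] All (x ∉ᶜ_) cs
avoid-cubes-of-codimension {N} d cs codim #cs<2^d = avoid-cubes N cs (*-cancelʳ-< (2 ^ d) _ _ (begin-strict
  volume cs * 2 ^ d    ≡⟨ volume-of-codimension cs codim ⟩
  length cs * 2 ^ N    <⟨ *-monoˡ-< (2 ^ N) {{m^n≢0 2 N}} #cs<2^d ⟩
  2 ^ d * 2 ^ N        ≡⟨ *-comm (2 ^ d) (2 ^ N) ⟩
  2 ^ N * 2 ^ d        ∎))
  where open ≤-Reasoning

-- Subsets, images and rectangles

subsetsOfSize : (r t : ℕ) → List (Subset r)
subsetsOfSize zero    zero    = [] ∷ []
subsetsOfSize zero    (suc t) = []
subsetsOfSize (suc r) zero    = map (outside ∷_) (subsetsOfSize r zero)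
subsetsOfSize (suc r) (suc t) = map (inside ∷_) (subsetsOfSize r t) ++ map (outside ∷_) (subsetsOfSize r (suc t))

length-subsetsOfSize : ∀ r t → length (subsetsOfSize r t) ≡ r C t
length-subsetsOfSize zero    zero    = refl
length-subsetsOfSize zero    (suc t) = refl
length-subsetsOfSize (suc r) zero    = trans (length-map _ (subsetsOfSize r zero)) (length-subsetsOfSize r zero)
length-subsetsOfSize (suc r) (suc t) = begin
  length (map (inside ∷_) (subsetsOfSize r t) ++ map (outside ∷_) (subsetsOfSize r (suc t)))
    ≡⟨ length-++ (map (inside ∷_) (subsetsOfSize r t)) ⟩
  length (map (inside ∷_) (subsetsOfSize r t)) + length (map (outside ∷_) (subsetsOfSize r (suc t)))
    ≡⟨ cong₂ _+_ (length-map _ (subsetsOfSize r t)) (length-map _ (subsetsOfSize r (suc t))) ⟩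
  length (subsetsOfSize r t) + length (subsetsOfSize r (suc t))
    ≡⟨ cong₂ _+_ (length-subsetsOfSize r t) (length-subsetsOfSize r (suc t)) ⟩
  r C t + r C suc t
    ≡⟨ nCk+nC[k+1]≡[n+1]C[k+1] r t ⟩
  suc r C suc t ∎
  where open ≡-Reasoning

∈-subsetsOfSize⁺ : ∀ {r} (T : Subset r) → T ∈ˡ subsetsOfSize r ∣ T ∣
∈-subsetsOfSize⁺ []            = Any.here refl
∈-subsetsOfSize⁺ (inside ∷ T)  = ∈-++⁺ˡ (∈-map⁺ (inside ∷_) (∈-subsetsOfSize⁺ T))
∈-subsetsOfSize⁺ (outside ∷ T) with ∣ T ∣ | ∈-subsetsOfSize⁺ T
... | zero  | T∈ = ∈-map⁺ (outside ∷_) T∈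
... | suc t | T∈ = ∈-++⁺ʳ (map (inside ∷_) (subsetsOfSize _ t)) (∈-map⁺ (outside ∷_) T∈)

∈-subsetsOfSize⁻ : ∀ {r t} {T : Subset r} → T ∈ˡ subsetsOfSize r t → ∣ T ∣ ≡ t
∈-subsetsOfSize⁻ {zero}  {zero}  (Any.here refl) = refl
∈-subsetsOfSize⁻ {suc r} {zero}  T∈ with ∈-map⁻ (outside ∷_) T∈
... | _ , T′∈ , refl = ∈-subsetsOfSize⁻ T′∈
∈-subsetsOfSize⁻ {suc r} {suc t} T∈ with ∈-++⁻ (map (inside ∷_) (subsetsOfSize r t)) T∈
... | inj₁ T∈ᵢ with ∈-map⁻ (inside ∷_) T∈ᵢ
...   | _ , T′∈ , refl = cong suc (∈-subsetsOfSize⁻ T′∈)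
∈-subsetsOfSize⁻ {suc r} {suc t} T∈ | inj₂ T∈ₒ with ∈-map⁻ (outside ∷_) T∈ₒ
...   | _ , T′∈ , refl = ∈-subsetsOfSize⁻ T′∈

image : ∀ {n r} → (Fin n → Fin r) → Subset r
image {zero}  f = ⊥
image {suc n} f = ⁅ f zero ⁆ ∪ image (f ∘ suc)

∈-image⁻ : ∀ {n r} (f : Fin n → Fin r) {i} → i ∈ image f → ∃[ a ] f a ≡ i
∈-image⁻ {zero}  f i∈ = contradiction i∈ ∉⊥
∈-image⁻ {suc n} f i∈ with x∈p∪q⁻ ⁅ f zero ⁆ (image (f ∘ suc)) i∈
... | inj₁ i∈⁅f0⁆ = zero , sym (x∈⁅y⁆⇒x≡y (f zero) i∈⁅f0⁆)
... | inj₂ i∈img  = let a , fa≡i = ∈-image⁻ (f ∘ suc) i∈img in suc a , fa≡i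

∣⁅x⁆∪p∣≡1+∣p∣ : ∀ {r} {x : Fin r} {p : Subset r} → x ∉ p → ∣ ⁅ x ⁆ ∪ p ∣ ≡ suc ∣ p ∣
∣⁅x⁆∪p∣≡1+∣p∣ {x = zero}  {inside  ∷ p} x∉p = contradiction here x∉p
∣⁅x⁆∪p∣≡1+∣p∣ {x = zero}  {outside ∷ p} _   = cong (suc ∘ ∣_∣) (∪-identityˡ p)
∣⁅x⁆∪p∣≡1+∣p∣ {x = suc x} {inside  ∷ p} x∉p = cong suc (∣⁅x⁆∪p∣≡1+∣p∣ (x∉p ∘ there))
∣⁅x⁆∪p∣≡1+∣p∣ {x = suc x} {outside ∷ p} x∉p = ∣⁅x⁆∪p∣≡1+∣p∣ (x∉p ∘ there)

∣image∣≡n : ∀ {n r} (f : Fin n → Fin r) → Injective _≡_ _≡_ f → ∣ image f ∣ ≡ n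
∣image∣≡n {zero}  {r} f _     = ∣⊥∣≡0 r
∣image∣≡n {suc n}     f f-inj =
  trans (∣⁅x⁆∪p∣≡1+∣p∣ f0∉) (cong suc (∣image∣≡n (f ∘ suc) (suc-injectiveᶠ ∘ f-inj)))
  where
  f0∉ : f zero ∉ image (f ∘ suc)
  f0∉ f0∈ with ∈-image⁻ (f ∘ suc) f0∈
  ... | a , fa≡f0 with f-inj fa≡f0
  ...   | ()

free-guarded : ∀ {m} (S : Subset m) col → free (λ j → if lookup S j then just col else nothing) + ∣ S ∣ ≡ m
free-guarded []            col = refl
free-guarded (inside  ∷ S) col = trans (+-suc _ ∣ S ∣) (cong suc (free-guarded S col))
free-guarded (outside ∷ S) col = cong suc (free-guarded S col)

rectangleEntry : ∀ {r m} → Subset r → Subset m → Bool → Fin r × Fin m → Maybe Bool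
rectangleEntry T S col (i , j) = if lookup T i ∧ lookup S j then just col else nothing

rectangle : ∀ {r m} → Subset r → Subset m → Bool → Cube (r * m)
rectangle {m = m} T S col = rectangleEntry T S col ∘ remQuot m

remQuot-↑ʳ : ∀ {r} m (q : Fin (r * m)) → remQuot {suc r} m (m ↑ʳ q) ≡ map₁ suc (remQuot m q)
remQuot-↑ʳ {r} m q rewrite splitAt-↑ʳ m (r * m) q = refl

free-rectangle : ∀ {r m} (T : Subset r) (S : Subset m) col → free (rectangle T S col) + ∣ T ∣ * ∣ S ∣ ≡ r * m
free-rectangle                 []      S col = refl
free-rectangle {suc r} {m} (t ∷ T) S col = begin
  free (rectangle (t ∷ T) S col) + ∣ t ∷ T ∣ * ∣ S ∣  ≡⟨ cong (_+ ∣ t ∷ T ∣ * ∣ S ∣) split-first-row ⟩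
  free (row t) + F + ∣ t ∷ T ∣ * ∣ S ∣                ≡⟨ count t ⟩
  m + r * m                                          ∎
  where
  open ≡-Reasoning
  open CommSemigroupProperties +-commutativeSemigroup using (interchange)
  row : Bool → Cube m
  row t j = rectangleEntry (t ∷ T) S col (zero , j)
  F = free (rectangle T S col)
  split-first-row : free (rectangle (t ∷ T) S col) ≡ free (row t) + F
  split-first-row = trans (free-++ m (rectangle (t ∷ T) S col)) (cong₂ _+_
    (free-cong (λ j → cong (rectangleEntry (t ∷ T) S col) (remQuot-combine zero j)))
    (free-cong (λ q → cong (rectangleEntry (t ∷ T) S col) (remQuot-↑ʳ m q))))
  count : ∀ t → free (row t) + F + ∣ t ∷ T ∣ * ∣ S ∣ ≡ m + r * m
  count inside  = trans (interchange (free (row inside)) F ∣ S ∣ (∣ T ∣ * ∣ S ∣))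
                        (cong₂ _+_ (free-guarded S col) (free-rectangle T S col))
  count outside = trans (cong (λ f → f + F + ∣ T ∣ * ∣ S ∣) (free-unconstrained m))
                        (trans (+-assoc m F (∣ T ∣ * ∣ S ∣)) (cong (m +_) (free-rectangle T S col)))

rectangle-∋ : ∀ {r m} (T : Subset r) (S : Subset m) col (x : Vector Bool (r * m)) →
              (∀ {i j} → i ∈ T → j ∈ S → x (combine {r} {m} i j) ≡ col) → x ∈ᶜ rectangle T S col
rectangle-∋ {r} {m} T S col x mono p {v} p↦v =
  subst (λ p → x p ≡ v) (combine-remQuot {r} m p) (entry (remQuot {r} m p) p↦v)
  where
  entry : ∀ ij → rectangleEntry T S col ij ≡ just v → x (uncurry combine ij) ≡ v
  entry (i , j) ij↦v with lookup T i in Tᵢ | lookup S j in Sⱼ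
  entry (i , j) ij↦v | true  | true  = trans (mono (lookup⇒[]= i T Tᵢ) (lookup⇒[]= j S Sⱼ)) (just-injective ij↦v)
  entry (i , j) ()   | true  | false
  entry (i , j) ()   | false | _

candidates : ∀ r m (t s : ℕ) → List (Cube (r * m))
candidates r m t s = cartesianProductWith (λ T → uncurry (rectangle T)) (subsetsOfSize r t)
                                           (cartesianProduct (subsetsOfSize m s) (true ∷ false ∷ []))

length-cartesianProductWith : ∀ {A B C : Set} (f : A → B → C) xs ys →
                              length (cartesianProductWith f xs ys) ≡ length xs * length ys
length-cartesianProductWith f []       ys = refl
length-cartesianProductWith f (x ∷ xs) ys = trans (length-++ (map (f x) ys))
  (cong₂ _+_ (length-map (f x) ys) (length-cartesianProductWith f xs ys))

length-candidates : ∀ r m t s → length (candidates r m t s) ≡ (r C t) * ((m C s) * 2)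
length-candidates r m t s = trans (length-cartesianProductWith _ (subsetsOfSize r t) _)
  (cong₂ _*_ (length-subsetsOfSize r t)
             (trans (length-cartesianProductWith _,_ (subsetsOfSize m s) _) (cong (_* 2) (length-subsetsOfSize m s))))

codimension-candidates : ∀ r m t s → All (λ c → free c + t * s ≡ r * m) (candidates r m t s)
codimension-candidates r m t s = tabulate λ c∈ → go c∈
  where
  go : ∀ {c} → c ∈ˡ candidates r m t s → free c + t * s ≡ r * m
  go c∈ with ∈-cartesianProductWith⁻ (λ T → uncurry (rectangle T)) (subsetsOfSize r t) _ c∈
  ... | T , (S , col) , T∈ , Scol∈ , refl =
    subst₂ (λ a b → free (rectangle T S col) + a * b ≡ r * m)
           (∈-subsetsOfSize⁻ T∈) (∈-subsetsOfSize⁻ (proj₁ (∈-cartesianProduct⁻ (subsetsOfSize m s) _ Scol∈)))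
           (free-rectangle T S col)

avoids-candidates⇒¬mono : ∀ r m {t s} (x : Vector Bool (r * m)) → All (x ∉ᶜ_) (candidates r m t s) →
                          ¬ HasMonoSubmatrix (λ i j → x (combine {r} {m} i j)) t s
avoids-candidates⇒¬mono r m {t} {s} x avoids (rows , cols , col , rows-inj , cols-inj , mono) =
  All-lookup avoids rectangle∈ (rectangle-∋ (image rows) (image cols) col x mono-on-image)
  where
  image∈ : ∀ {n k} (f : Fin n → Fin k) → Injective _≡_ _≡_ f → image f ∈ˡ subsetsOfSize k n
  image∈ f f-inj = subst (λ n → image f ∈ˡ subsetsOfSize _ n) (∣image∣≡n f f-inj) (∈-subsetsOfSize⁺ (image f))
  col∈ : ∀ col → col ∈ˡ true ∷ false ∷ []
  col∈ true  = Any.here refl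
  col∈ false = Any.there (Any.here refl)
  rectangle∈ : rectangle (image rows) (image cols) col ∈ˡ candidates r m t s
  rectangle∈ = ∈-cartesianProductWith⁺ (λ T → uncurry (rectangle T))
                 (image∈ rows rows-inj) (∈-cartesianProduct⁺ (image∈ cols cols-inj) (col∈ col))
  mono-on-image : ∀ {i j} → i ∈ image rows → j ∈ image cols → x (combine {r} {m} i j) ≡ col
  mono-on-image i∈ j∈ with ∈-image⁻ rows i∈ | ∈-image⁻ cols j∈
  ... | a , refl | b , refl = mono a b

lemma2 : (n : ℕ) → 2 ≤ n → (k : ℕ) → IsFloorNOver2Log2 n k →
    Σ (Coloring ((n * n) / 6) (2 ^ k)) (λ M → ¬ HasMonoSubmatrix M n ⌈log₂ n ⌉)
lemma2 n 2≤n k (n^2k≤2^n , _) =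
  let x , avoids = avoid-cubes-of-codimension (n * b) (candidates r m n b) (codimension-candidates r m n b)
                     few-candidates
  in (λ i j → x (combine i j)) , avoids-candidates⇒¬mono r m x avoids
  where
  r = n * n / 6
  m = 2 ^ k
  b = ⌈log₂ n ⌉
  few-candidates : length (candidates r m n b) < 2 ^ (n * b)
  few-candidates = subst (_< 2 ^ (n * b)) (sym (length-candidates r m n b))
                         (union-bound-estimate n k 2≤n n^2k≤2^n)
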